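{- The functors $(-)^+\colon\mathsf{ULM}\to\mathsf{ULMP}$ and $T\colon\mathsf{ULMP}\to\mathsf{ULM}$ are quasi-inverses, i.e. $T\circ(-)^+$ is naturally isomorphic to the identity functor on $\mathsf{ULM}$ and $(-)^+\circ T$ is naturally isomorphic to the identity functor on $\mathsf{ULMP}$.
   Context: A commutative lattice-ordered monoid is an algebra $\langle M;+,\vee,\wedge,0\rangle$ with $\langle M;\vee,\wedge\rangle$ a distributive lattice, $\langle M;+,0\rangle$ a commutative monoid, and $+$ distributing over $\vee$ and $\wedge$. A unital commutative lattice-ordered monoid (ulm) is an algebra $\langle M;+,\vee,\wedge,0,1,-1\rangle$ whose $\{+,\vee,\wedge,0\}$-reduct is a commutative lattice-ordered monoid, with $-1+1=0$, $0\le1$, and for each $x$ some $n\in\mathbb{N}$ with $-n\le x\le n$ (where $n=1+\dots+1$, $-n=(-1)+\dots+(-1)$, $n$ summands). $\mathsf{ULM}$ denotes the category of ulms with homomorphisms. A positive unital commutative lattice-ordered monoid (pulm) is an algebra $\langle M;+,\vee,\wedge,0,1,-\ominus1\rangle$ (arities $2,2,2,0,0,1$) whose $\{+,\vee,\wedge,0\}$-reduct is a commutative lattice-ordered monoid and such that for all $x\in M$: $x\ge0$; $(x+1)\ominus1=x$; $(x\ominus1)+1=x\vee1$; and $x\le n$ for some $n\in\mathbb{N}$. $\mathsf{ULMP}$ is the category of pulms with homomorphisms. The functor $(-)^+$ sends a ulm $M$ to $M^+=\{x\in M\mid x\ge0\}$ with $+,\vee,\wedge,0,1$ restricted and $x\ominus1=(x+(-1))\vee0$,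 and a homomorphism to its restriction. For a pulm $M$, $T(M)$ is the quotient of $M\times\mathbb{N}$ by $(x,n)\sim(y,m)\iff x+m=y+n$ (writing $[x,n]$ for classes), with $0=[0,0]$, $1=[1,0]$, $-1=[0,1]$, $[x,n]+[y,m]=[x+y,n+m]$, $[x,n]\vee[y,m]=[(x+m)\vee(y+n),n+m]$, $[x,n]\wedge[y,m]=[(x+m)\wedge(y+n),n+m]$; for a homomorphism $f$, $T(f)[x,n]=[f(x),n]$. -}

module Defs where

open import Level using (Level; _⊔_)
open import Data.Nat as ℕ using (ℕ; zero) renaming (suc to 1+)
import Data.Nat.Properties as ℕP
open import Data.Product using (Σ; _×_; _,_; proj₁; proj₂; ∃-syntax)
open import Relation.Binary.Core using (Rel)
open import Relation.Binary.Bundles using (Setoid)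
open import Relation.Binary.PropositionalEquality as P using (_≡_)
open import Algebra.Core using (Op₂)
import Algebra.Definitions as AD
import Algebra.Structures as AS
import Algebra.Lattice.Structures as ALS

record RawULM (c ℓ : Level) : Set (Level.suc (c ⊔ ℓ)) where
  infix 4 _≈_ _≤_
  field
    Carrier : Set c
    _≈_     : Rel Carrier ℓ
    _+_     : Op₂ Carrier
    _∨_     : Op₂ Carrier
    _∧_     : Op₂ Carrier
    0#      : Carrier
    1#      : Carrier
    -1#     : Carrier

  nat : ℕ → Carrier
  nat zero   = 0#
  nat (1+ n) = nat n + 1#

  neg : ℕ → Carrier
  neg zero   = 0#
  neg (1+ n) = neg n + -1#

  _≤_ : Rel Carrier ℓ
  x ≤ y = (x ∨ y) ≈ y

record RawULMP (c ℓ : Level) : Set (Level.suc (c ⊔ ℓ)) where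
  infix 4 _≈_ _≤_
  field
    Carrier : Set c
    _≈_     : Rel Carrier ℓ
    _+_     : Op₂ Carrier
    _∨_     : Op₂ Carrier
    _∧_     : Op₂ Carrier
    0#      : Carrier
    1#      : Carrier
    _⊖1     : Carrier → Carrier

  nat : ℕ → Carrier
  nat zero   = 0#
  nat (1+ n) = nat n + 1#

  _≤_ : Rel Carrier ℓ
  x ≤ y = (x ∨ y) ≈ y

record IsCLM {c ℓ} {A : Set c} (_≈_ : Rel A ℓ) (_+_ _∨_ _∧_ : Op₂ A) (0# : A)
             : Set (c ⊔ ℓ) where
  field
    isDistributiveLattice : ALS.IsDistributiveLattice _≈_ _∨_ _∧_
    +-isCommutativeMonoid : AS.IsCommutativeMonoid _≈_ _+_ 0#
    +-distrib-∨           : AD._DistributesOver_ _≈_ _+_ _∨_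
    +-distrib-∧           : AD._DistributesOver_ _≈_ _+_ _∧_

record ULM (c ℓ : Level) : Set (Level.suc (c ⊔ ℓ)) where
  field
    raw : RawULM c ℓ
  open RawULM raw public
  field
    isCLM   : IsCLM _≈_ _+_ _∨_ _∧_ 0#
    -1+1≈0  : (-1# + 1#) ≈ 0#
    0≤1     : 0# ≤ 1#
    bounded : ∀ x → ∃[ n ] ((neg n ≤ x) × (x ≤ nat n))

record ULMP (c ℓ : Level) : Set (Level.suc (c ⊔ ℓ)) where
  field
    raw : RawULMP c ℓ
  open RawULMP raw public
  field
    isCLM   : IsCLM _≈_ _+_ _∨_ _∧_ 0#
    ⊖1-cong : ∀ {x y} → x ≈ y → (x ⊖1) ≈ (y ⊖1)
    nonneg  : ∀ x → 0# ≤ x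
    +1⊖1    : ∀ x → ((x + 1#) ⊖1) ≈ x
    ⊖1+1    : ∀ x → ((x ⊖1) + 1#) ≈ (x ∨ 1#)
    bounded : ∀ x → ∃[ n ] (x ≤ nat n)

module _ {a b c d} (M : RawULM a b) (N : RawULM c d) where
  private
    module M = RawULM M
    module N = RawULM N

  record ULMHom : Set (a ⊔ b ⊔ c ⊔ d) where
    field
      ⟦_⟧    : M.Carrier → N.Carrier
      cong   : ∀ {x y} → x M.≈ y → ⟦ x ⟧ N.≈ ⟦ y ⟧
      +-homo : ∀ x y → ⟦ x M.+ y ⟧ N.≈ (⟦ x ⟧ N.+ ⟦ y ⟧)
      ∨-homo : ∀ x y → ⟦ x M.∨ y ⟧ N.≈ (⟦ x ⟧ N.∨ ⟦ y ⟧)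
      ∧-homo : ∀ x y → ⟦ x M.∧ y ⟧ N.≈ (⟦ x ⟧ N.∧ ⟦ y ⟧)
      0-homo : ⟦ M.0# ⟧ N.≈ N.0#
      1-homo : ⟦ M.1# ⟧ N.≈ N.1#
      -1-homo : ⟦ M.-1# ⟧ N.≈ N.-1#

module _ {a b c d} (M : RawULMP a b) (N : RawULMP c d) where
  private
    module M = RawULMP M
    module N = RawULMP N

  record ULMPHom : Set (a ⊔ b ⊔ c ⊔ d) where
    field
      ⟦_⟧    : M.Carrier → N.Carrier
      cong   : ∀ {x y} → x M.≈ y → ⟦ x ⟧ N.≈ ⟦ y ⟧
      +-homo : ∀ x y → ⟦ x M.+ y ⟧ N.≈ (⟦ x ⟧ N.+ ⟦ y ⟧)
      ∨-homo : ∀ x y → ⟦ x M.∨ y ⟧ N.≈ (⟦ x ⟧ N.∨ ⟦ y ⟧)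
      ∧-homo : ∀ x y → ⟦ x M.∧ y ⟧ N.≈ (⟦ x ⟧ N.∧ ⟦ y ⟧)
      0-homo : ⟦ M.0# ⟧ N.≈ N.0#
      1-homo : ⟦ M.1# ⟧ N.≈ N.1#
      ⊖1-homo : ∀ x → ⟦ x M.⊖1 ⟧ N.≈ (⟦ x ⟧ N.⊖1)

module _ {a b c d} (M : RawULM a b) (N : RawULM c d) where
  private
    module M = RawULM M
    module N = RawULM N

  record ULMIso : Set (a ⊔ b ⊔ c ⊔ d) where
    field
      to      : ULMHom M N
      from    : ULMHom N M
      from∘to : ∀ x → ULMHom.⟦ from ⟧ (ULMHom.⟦ to ⟧ x) M.≈ x
      to∘from : ∀ y → ULMHom.⟦ to ⟧ (ULMHom.⟦ from ⟧ y) N.≈ y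

module _ {a b c d} (M : RawULMP a b) (N : RawULMP c d) where
  private
    module M = RawULMP M
    module N = RawULMP N

  record ULMPIso : Set (a ⊔ b ⊔ c ⊔ d) where
    field
      to      : ULMPHom M N
      from    : ULMPHom N M
      from∘to : ∀ x → ULMPHom.⟦ from ⟧ (ULMPHom.⟦ to ⟧ x) M.≈ x
      to∘from : ∀ y → ULMPHom.⟦ to ⟧ (ULMPHom.⟦ from ⟧ y) N.≈ y

module CLMProps {c ℓ} {A : Set c} {_≈_ : Rel A ℓ} {_+_ _∨_ _∧_ : Op₂ A} {0# : A}
                (clm : IsCLM _≈_ _+_ _∨_ _∧_ 0#) where
  open IsCLM clm
  open ALS.IsDistributiveLattice isDistributiveLattice public
  open AS.IsCommutativeMonoid +-isCommutativeMonoid public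
    using () renaming (assoc to +-assoc; comm to +-comm; identityˡ to +-identityˡ;
                       identityʳ to +-identityʳ; ∙-cong to +-cong;
                       ∙-congˡ to +-congˡ; ∙-congʳ to +-congʳ)

  setoid : Setoid c ℓ
  setoid = record { isEquivalence = isEquivalence }
  open import Relation.Binary.Reasoning.Setoid setoid

  infix 4 _≤_
  _≤_ : Rel A ℓ
  x ≤ y = (x ∨ y) ≈ y

  ∨-idem : ∀ x → (x ∨ x) ≈ x
  ∨-idem x = trans (∨-congˡ (sym (∧-absorbs-∨ x x))) (∨-absorbs-∧ x (x ∨ x))

  ≤-refl : ∀ x → x ≤ x
  ≤-refl = ∨-idem

  ≤-trans : ∀ {a b d} → a ≤ b → b ≤ d → a ≤ d
  ≤-trans {a} {b} {d} p q = begin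
    a ∨ d        ≈⟨ ∨-congˡ (sym q) ⟩
    a ∨ (b ∨ d)  ≈⟨ sym (∨-assoc a b d) ⟩
    (a ∨ b) ∨ d  ≈⟨ ∨-congʳ p ⟩
    b ∨ d        ≈⟨ q ⟩
    d            ∎

  ≤-respˡ : ∀ {a a' b} → a ≈ a' → a ≤ b → a' ≤ b
  ≤-respˡ e p = trans (∨-congʳ (sym e)) p

  ≤-respʳ : ∀ {a b b'} → b ≈ b' → a ≤ b → a ≤ b'
  ≤-respʳ e p = trans (∨-congˡ (sym e)) (trans p e)

  x≤x∨y : ∀ x y → x ≤ (x ∨ y)
  x≤x∨y x y = trans (sym (∨-assoc x x y)) (∨-congʳ (∨-idem x))

  y≤x∨y : ∀ x y → y ≤ (x ∨ y)
  y≤x∨y x y = ≤-respʳ (∨-comm y x) (x≤x∨y y x)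

  ≤-glb : ∀ {a b d} → a ≤ b → a ≤ d → a ≤ (b ∧ d)
  ≤-glb {a} {b} {d} p q = trans (proj₁ ∨-distrib-∧ a b d) (∧-cong p q)

  +-monoˡ : ∀ {a b} d → a ≤ b → (a + d) ≤ (b + d)
  +-monoˡ {a} {b} d p = trans (sym (proj₂ +-distrib-∨ d a b)) (+-congʳ p)

  +-monoʳ : ∀ {a b} d → a ≤ b → (d + a) ≤ (d + b)
  +-monoʳ {a} {b} d p =
    ≤-respˡ (+-comm a d) (≤-respʳ (+-comm b d) (+-monoˡ d p))

module _ {c ℓ} (R : RawULM c ℓ) where
  open RawULM R

  record PosClosed : Set (c ⊔ ℓ) where
    field
      0-pos : 0# ≤ 0#
      1-pos : 0# ≤ 1#
      +-pos : ∀ {x y} → 0# ≤ x → 0# ≤ y → 0# ≤ (x + y)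
      ∨-pos : ∀ {x y} → 0# ≤ x → 0# ≤ y → 0# ≤ (x ∨ y)
      ∧-pos : ∀ {x y} → 0# ≤ x → 0# ≤ y → 0# ≤ (x ∧ y)
      ⊖-pos : ∀ {x} → 0# ≤ x → 0# ≤ ((x + -1#) ∨ 0#)

  posPart : PosClosed → RawULMP (c ⊔ ℓ) ℓ
  posPart cl = record
    { Carrier = Σ Carrier (λ x → 0# ≤ x)
    ; _≈_     = λ p q → proj₁ p ≈ proj₁ q
    ; _+_     = λ p q → (proj₁ p + proj₁ q) , +-pos (proj₂ p) (proj₂ q)
    ; _∨_     = λ p q → (proj₁ p ∨ proj₁ q) , ∨-pos (proj₂ p) (proj₂ q)
    ; _∧_     = λ p q → (proj₁ p ∧ proj₁ q) , ∧-pos (proj₂ p) (proj₂ q)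
    ; 0#      = 0# , 0-pos
    ; 1#      = 1# , 1-pos
    ; _⊖1     = λ p → ((proj₁ p + -1#) ∨ 0#) , ⊖-pos (proj₂ p)
    }
    where open PosClosed cl

ulm-posClosed : ∀ {c ℓ} (M : ULM c ℓ) → PosClosed (ULM.raw M)
ulm-posClosed M = record
  { 0-pos = ≤-refl 0#
  ; 1-pos = 0≤1
  ; +-pos = λ {x} {y} p q →
      ≤-trans (≤-respˡ (+-identityˡ 0#) (+-monoˡ 0# p))
        (≤-respˡ (trans (+-identityʳ x) (sym (+-identityʳ x))) (+-monoʳ x q))
  ; ∨-pos = λ {x} {y} p q → ≤-trans p (x≤x∨y x y)
  ; ∧-pos = λ p q → ≤-glb p q
  ; ⊖-pos = λ {x} _ → y≤x∨y (x + -1#) 0#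
  }
  where open ULM M using (isCLM; 0≤1; 0#; -1#; _+_)
        open CLMProps isCLM

_⁺ : ∀ {c ℓ} → ULM c ℓ → RawULMP (c ⊔ ℓ) ℓ
M ⁺ = posPart (ULM.raw M) (ulm-posClosed M)

hom-pos : ∀ {c ℓ} {M N : ULM c ℓ} (f : ULMHom (ULM.raw M) (ULM.raw N)) →
          ∀ {x} → ULM._≤_ M (ULM.0# M) x →
          ULM._≤_ N (ULM.0# N) (ULMHom.⟦ f ⟧ x)
hom-pos {M = M} {N} f {x} p =
  trans (∨-congʳ (sym 0-homo)) (trans (sym (∨-homo (ULM.0# M) x)) (cong p))
  where open ULMHom f
        open CLMProps (ULM.isCLM N)

plusMap : ∀ {c ℓ} {M N : ULM c ℓ} → ULMHom (ULM.raw M) (ULM.raw N) →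
          RawULMP.Carrier (M ⁺) → RawULMP.Carrier (N ⁺)
plusMap {M = M} {N} f (x , p) = ULMHom.⟦ f ⟧ x , hom-pos {M = M} {N} f p

-- The functor T : ULMP → ULM, T(M) = (M × ℕ)/~ presented as a setoid:
-- (x , n) ~ (y , m)  iff  x + m = y + n.

T : ∀ {c ℓ} → RawULMP c ℓ → RawULM c ℓ
T M = record
  { Carrier = Carrier × ℕ
  ; _≈_     = λ { (x , n) (y , m) → (x + nat m) ≈ (y + nat n) }
  ; _+_     = λ { (x , n) (y , m) → (x + y) , (n ℕ.+ m) }
  ; _∨_     = λ { (x , n) (y , m) → ((x + nat m) ∨ (y + nat n)) , (n ℕ.+ m) }
  ; _∧_     = λ { (x , n) (y , m) → ((x + nat m) ∧ (y + nat n)) , (n ℕ.+ m) }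
  ; 0#      = 0# , 0
  ; 1#      = 1# , 0
  ; -1#     = 0# , 1
  }
  where open RawULMP M

Tmap : ∀ {a b c d} {M : RawULMP a b} {N : RawULMP c d} →
       (RawULMP.Carrier M → RawULMP.Carrier N) →
       RawULM.Carrier (T M) → RawULM.Carrier (T N)
Tmap f (x , n) = f x , n

module PulmFacts {c ℓ} (M : ULMP c ℓ) where
  open ULMP M using (raw; isCLM; ⊖1-cong; nonneg; +1⊖1; Carrier; nat; 0#; 1#; _⊖1; _≈_)
  open RawULMP raw using (_+_; _∨_; _∧_)
  open CLMProps isCLM

  nat-+ : ∀ n m → nat (n ℕ.+ m) ≈ (nat n + nat m)
  nat-+ zero m = sym (+-identityˡ (nat m))
  nat-+ (1+ n) m =
    trans (+-congʳ (nat-+ n m))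
     (trans (+-assoc (nat n) (nat m) 1#)
      (trans (+-congˡ (+-comm (nat m) 1#)) (sym (+-assoc (nat n) 1# (nat m)))))

  cancel1 : ∀ {x y} → (x + 1#) ≈ (y + 1#) → x ≈ y
  cancel1 {x} {y} e = trans (sym (+1⊖1 x)) (trans (⊖1-cong e) (+1⊖1 y))

  cancel : ∀ n {x y} → (x + nat n) ≈ (y + nat n) → x ≈ y
  cancel zero {x} {y} e = trans (sym (+-identityʳ x)) (trans e (+-identityʳ y))
  cancel (1+ n) {x} {y} e =
    cancel n (cancel1 (trans (+-assoc x (nat n) 1#) (trans e (sym (+-assoc y (nat n) 1#)))))

  private module TM = RawULM (T raw)

  pos⇐ : ∀ x n → nat n ≤ x → TM._≤_ TM.0# (x , n)
  pos⇐ x n p = +-congʳ (trans (∨-cong (+-identityˡ (nat n)) (+-identityʳ x)) p)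

  pos⇒ : ∀ x n → TM._≤_ TM.0# (x , n) → nat n ≤ x
  pos⇒ x n p = trans (sym (∨-cong (+-identityˡ (nat n)) (+-identityʳ x))) (cancel n p)

  T-posClosed : PosClosed (T raw)
  T-posClosed = record
    { 0-pos = pos⇐ 0# 0 (≤-refl 0#)
    ; 1-pos = pos⇐ 1# 0 (nonneg 1#)
    ; +-pos = λ { {x , n} {y , m} p q →
        pos⇐ (x + y) (n ℕ.+ m)
          (≤-respˡ (sym (nat-+ n m))
            (≤-trans (+-monoˡ (nat m) (pos⇒ x n p)) (+-monoʳ x (pos⇒ y m q)))) }
    ; ∨-pos = λ { {x , n} {y , m} p q →
        pos⇐ _ (n ℕ.+ m)
          (≤-respˡ (sym (nat-+ n m))
            (≤-trans (+-monoˡ (nat m) (pos⇒ x n p)) (x≤x∨y _ _))) }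
    ; ∧-pos = λ { {x , n} {y , m} p q →
        pos⇐ _ (n ℕ.+ m)
          (≤-respˡ (sym (nat-+ n m))
            (≤-glb (+-monoˡ (nat m) (pos⇒ x n p))
                   (≤-respˡ (+-comm (nat m) (nat n)) (+-monoˡ (nat n) (pos⇒ y m q))))) }
    ; ⊖-pos = λ { {x , n} _ →
        pos⇐ _ ((n ℕ.+ 1) ℕ.+ 0)
          (≤-respˡ (trans (+-identityˡ _) (reflexive (P.cong nat (P.sym (ℕP.+-identityʳ (n ℕ.+ 1))))))
            (y≤x∨y _ _)) }
    }

  hom-nat : ∀ {N : ULMP c ℓ} (f : ULMPHom raw (ULMP.raw N)) n →
            ULMP._≈_ N (ULMPHom.⟦ f ⟧ (nat n)) (ULMP.nat N n)
  hom-nat {N} f zero = ULMPHom.0-homo f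
  hom-nat {N} f (1+ n) =
    N.trans (ULMPHom.+-homo f (nat n) 1#)
            (N.+-cong (hom-nat {N} f n) (ULMPHom.1-homo f))
    where module N = CLMProps (ULMP.isCLM N)

T⁺ : ∀ {c ℓ} → ULMP c ℓ → RawULMP (c ⊔ ℓ) ℓ
T⁺ M = posPart (T (ULMP.raw M)) (PulmFacts.T-posClosed M)

Thom-pos : ∀ {c ℓ} {M N : ULMP c ℓ} (f : ULMPHom (ULMP.raw M) (ULMP.raw N)) →
           ∀ x n → RawULM._≤_ (T (ULMP.raw M)) (RawULM.0# (T (ULMP.raw M))) (x , n) →
           RawULM._≤_ (T (ULMP.raw N)) (RawULM.0# (T (ULMP.raw N))) (ULMPHom.⟦ f ⟧ x , n)
Thom-pos {M = M} {N} f x n p =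
  N.pos⇐ (⟦ f ⟧ x) n
    (N.≤-respˡ (M.hom-nat {N} f n)
      (N.trans (N.sym (ULMPHom.∨-homo f (ULMP.nat M n) x)) (ULMPHom.cong f (M.pos⇒ x n p))))
  where module M = PulmFacts M
        module N where
          open PulmFacts N public
          open CLMProps (ULMP.isCLM N) public
        open ULMPHom

TplusMap : ∀ {c ℓ} {M N : ULMP c ℓ} → ULMPHom (ULMP.raw M) (ULMP.raw N) →
           RawULMP.Carrier (T⁺ M) → RawULMP.Carrier (T⁺ N)
TplusMap {M = M} {N} f ((x , n) , p) =
  Tmap {M = ULMP.raw M} {ULMP.raw N} (ULMPHom.⟦ f ⟧) (x , n) , Thom-pos {M = M} {N} f x n p

-- In a ulm M every element is a difference x − n of a positive x and a natural n,
-- because −n ≤ x ≤ n for some n; and n has the inverse −n, so [x , n] ↦ x + (−n)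
-- is a homomorphism T(M⁺) → M that reflects equality, hence an isomorphism.
-- In a pulm M the operation ⊖1 subtracts 1 from every element ≥ 1, so a positive
-- class [x , n] (that is, n ≤ x) is sent to x ⊖ n, the unique z with z + n = x;
-- uniqueness holds because (x + 1) ⊖ 1 = x makes + 1 cancellable. Naturality is
-- immediate, since homomorphisms preserve −1 and ⊖1.

module Submission where

open import Data.Nat as ℕ using (ℕ; zero) renaming (suc to 1+)
import Data.Nat.Properties as ℕP
open import Data.Product using (_,_; proj₁; proj₂; Σ-syntax; _×_)
import Relation.Binary.PropositionalEquality as P
open import Algebra.Core using (Op₂)
open import Algebra.Bundles using (CommutativeMonoid)
import Algebra.Definitions as AD
import Algebra.Properties.CommutativeSemigroup as CommutativeSemigroupProperties
open import Relation.Binary.Core using (Rel)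
open import Defs

module InversePairs {a ℓ} (M : CommutativeMonoid a ℓ) where
  open CommutativeMonoid M
  open CommutativeSemigroupProperties commutativeSemigroup using (interchange)
  open import Relation.Binary.Reasoning.Setoid setoid

  ∙-inverse : ∀ {u u′ v v′} → u ∙ u′ ≈ ε → v ∙ v′ ≈ ε → (u ∙ v) ∙ (u′ ∙ v′) ≈ ε
  ∙-inverse {u} {u′} {v} {v′} e f =
    trans (interchange u v u′ v′) (trans (∙-cong e f) (identityˡ ε))

  ∙-cancel-inverse : ∀ {u u′} x y → u ∙ u′ ≈ ε → (x ∙ u) ∙ (y ∙ u′) ≈ x ∙ y
  ∙-cancel-inverse {u} {u′} x y e =
    trans (interchange x u y u′) (trans (∙-congˡ e) (identityʳ (x ∙ y)))

  transpose-inverses : ∀ {u u′ v v′ x y} → u ∙ u′ ≈ ε → v ∙ v′ ≈ ε →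
                       x ∙ v ≈ y ∙ u → x ∙ u′ ≈ y ∙ v′
  transpose-inverses {u} {u′} {v} {v′} {x} {y} uu′ vv′ e = begin
    x ∙ u′               ≈⟨ ∙-cancel-inverse x u′ vv′ ⟨
    (x ∙ v) ∙ (u′ ∙ v′)  ≈⟨ ∙-cong e (comm u′ v′) ⟩
    (y ∙ u) ∙ (v′ ∙ u′)  ≈⟨ ∙-cancel-inverse y v′ uu′ ⟩
    y ∙ v′               ∎

+-commutativeMonoid : ∀ {c ℓ} {A : Set c} {_≈_ : Rel A ℓ} {_+_ _∨_ _∧_ : Op₂ A} {0# : A} →
                      IsCLM _≈_ _+_ _∨_ _∧_ 0# → CommutativeMonoid c ℓ
+-commutativeMonoid clm = record { isCommutativeMonoid = IsCLM.+-isCommutativeMonoid clm }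

module _ {c ℓ c′ ℓ′} {A : RawULM c ℓ} (B : ULM c′ ℓ′) (h : ULMHom A (ULM.raw B))
         (g : ULM.Carrier B → RawULM.Carrier A) where
  private
    module A = RawULM A
    open ULM B using (Carrier; _≈_; isCLM)
    open CLMProps isCLM using (sym; trans; setoid; +-cong; ∨-cong; ∧-cong)
    open ULMHom h
    open AD _≈_ using (Congruent₂)
    open import Relation.Binary.Reasoning.Setoid setoid

  reflecting+section⇒ULMIso : (∀ y → ⟦ g y ⟧ ≈ y) → (∀ {p q} → ⟦ p ⟧ ≈ ⟦ q ⟧ → p A.≈ q) →
                              ULMIso A (ULM.raw B)
  reflecting+section⇒ULMIso h∘g h-reflects = record
    { to      = h
    ; from    = record
      { ⟦_⟧     = g
      ; cong    = λ {y} {y′} e → h-reflects (trans (h∘g y) (trans e (sym (h∘g y′))))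
      ; +-homo  = g-homo₂ +-cong +-homo
      ; ∨-homo  = g-homo₂ ∨-cong ∨-homo
      ; ∧-homo  = g-homo₂ ∧-cong ∧-homo
      ; 0-homo  = g-homo₀ 0-homo
      ; 1-homo  = g-homo₀ 1-homo
      ; -1-homo = g-homo₀ -1-homo
      }
    ; from∘to = λ p → h-reflects (h∘g ⟦ p ⟧)
    ; to∘from = h∘g
    }
    where
    g-homo₀ : ∀ {a b} → ⟦ a ⟧ ≈ b → g b A.≈ a
    g-homo₀ {b = b} e = h-reflects (trans (h∘g b) (sym e))

    g-homo₂ : ∀ {_•_ : Op₂ A.Carrier} {_◦_ : Op₂ Carrier} → Congruent₂ _◦_ →
              (∀ p q → ⟦ p • q ⟧ ≈ ⟦ p ⟧ ◦ ⟦ q ⟧) → ∀ x y → g (x ◦ y) A.≈ (g x • g y)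
    g-homo₂ {_•_} {_◦_} ◦-cong h-homo x y = h-reflects (begin
      ⟦ g (x ◦ y) ⟧        ≈⟨ h∘g (x ◦ y) ⟩
      x ◦ y                ≈⟨ ◦-cong (h∘g x) (h∘g y) ⟨
      ⟦ g x ⟧ ◦ ⟦ g y ⟧    ≈⟨ h-homo (g x) (g y) ⟨
      ⟦ g x • g y ⟧        ∎)

module TPositive {c ℓ} (M : ULM c ℓ) where
  open ULM M
  open CLMProps isCLM hiding (_≤_)
  open IsCLM isCLM using (+-distrib-∨; +-distrib-∧)
  open AD _≈_ using (Congruent₂; _DistributesOverʳ_)
  open import Relation.Binary.Reasoning.Setoid setoid

  open InversePairs (+-commutativeMonoid isCLM)
  open CommutativeSemigroupProperties (CommutativeMonoid.commutativeSemigroup (+-commutativeMonoid isCLM))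
    using (interchange)

  neg-+ : ∀ m n → neg (m ℕ.+ n) ≈ neg m + neg n
  neg-+ zero   n = sym (+-identityˡ (neg n))
  neg-+ (1+ m) n = begin
    neg (m ℕ.+ n) + -1#      ≈⟨ +-congʳ (neg-+ m n) ⟩
    (neg m + neg n) + -1#    ≈⟨ +-assoc (neg m) (neg n) -1# ⟩
    neg m + (neg n + -1#)    ≈⟨ +-congˡ (+-comm (neg n) -1#) ⟩
    neg m + (-1# + neg n)    ≈⟨ +-assoc (neg m) -1# (neg n) ⟨
    (neg m + -1#) + neg n    ∎

  nat+neg≈0 : ∀ n → nat n + neg n ≈ 0#
  nat+neg≈0 zero   = +-identityʳ 0#
  nat+neg≈0 (1+ n) = ∙-inverse (nat+neg≈0 n) (trans (+-comm 1# -1#) -1+1≈0)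

  neg+nat≈0 : ∀ n → neg n + nat n ≈ 0#
  neg+nat≈0 n = trans (+-comm (neg n) (nat n)) (nat+neg≈0 n)

  private
    module M⁺ = RawULMP (M ⁺)
    module TM⁺ = RawULM (T (M ⁺))

  nat⁺≈nat : ∀ n → proj₁ (M⁺.nat n) ≈ nat n
  nat⁺≈nat zero   = refl
  nat⁺≈nat (1+ n) = +-congʳ (nat⁺≈nat n)

  difference : TM⁺.Carrier → Carrier
  difference ((x , _) , n) = x + neg n

  +nat-neg-cancel : ∀ x n m → (x + nat m) + neg (n ℕ.+ m) ≈ x + neg n
  +nat-neg-cancel x n m =
    trans (+-congˡ (neg-+ n m)) (∙-cancel-inverse x (neg n) (nat+neg≈0 m))

  difference-distribʳ : ∀ {_•_} → Congruent₂ _•_ → _+_ DistributesOverʳ _•_ →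
                        ∀ x n y m → ((x + nat m) • (y + nat n)) + neg (n ℕ.+ m) ≈ (x + neg n) • (y + neg m)
  difference-distribʳ {_•_} •-cong distribʳ x n y m = begin
    ((x + nat m) • (y + nat n)) + neg (n ℕ.+ m)
      ≈⟨ distribʳ (neg (n ℕ.+ m)) (x + nat m) (y + nat n) ⟩
    ((x + nat m) + neg (n ℕ.+ m)) • ((y + nat n) + neg (n ℕ.+ m))
      ≈⟨ •-cong (+nat-neg-cancel x n m)
                (trans (+-congˡ (reflexive (P.cong neg (ℕP.+-comm n m)))) (+nat-neg-cancel y m n)) ⟩
    (x + neg n) • (y + neg m)
      ∎

  differenceHom : ULMHom (T (M ⁺)) raw
  differenceHom = record
    { ⟦_⟧     = difference
    ; cong    = λ { {(x , _) , n} {(y , _) , m} e →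
        transpose-inverses (nat+neg≈0 n) (nat+neg≈0 m) (lower-nat⁺ m n e) }
    ; +-homo  = λ { ((x , _) , n) ((y , _) , m) →
        trans (+-congˡ (neg-+ n m)) (interchange x y (neg n) (neg m)) }
    ; ∨-homo  = λ { ((x , _) , n) ((y , _) , m) →
        trans (+-congʳ (∨-cong (+-congˡ (nat⁺≈nat m)) (+-congˡ (nat⁺≈nat n))))
              (difference-distribʳ ∨-cong (proj₂ +-distrib-∨) x n y m) }
    ; ∧-homo  = λ { ((x , _) , n) ((y , _) , m) →
        trans (+-congʳ (∧-cong (+-congˡ (nat⁺≈nat m)) (+-congˡ (nat⁺≈nat n))))
              (difference-distribʳ ∧-cong (proj₂ +-distrib-∧) x n y m) }
    ; 0-homo  = +-identityʳ 0#
    ; 1-homo  = +-identityʳ 1#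
    ; -1-homo = trans (+-identityˡ (0# + -1#)) (+-identityˡ -1#)
    }
    where
    lower-nat⁺ : ∀ {x y} m n → x + proj₁ (M⁺.nat m) ≈ y + proj₁ (M⁺.nat n) → x + nat m ≈ y + nat n
    lower-nat⁺ m n e = trans (+-congˡ (sym (nat⁺≈nat m))) (trans e (+-congˡ (nat⁺≈nat n)))

  difference-reflects : ∀ {p q} → difference p ≈ difference q → p TM⁺.≈ q
  difference-reflects {(x , _) , n} {(y , _) , m} e =
    trans (+-congˡ (nat⁺≈nat m))
          (trans (transpose-inverses (neg+nat≈0 m) (neg+nat≈0 n) e) (+-congˡ (sym (nat⁺≈nat n))))

  representative : Carrier → TM⁺.Carrier
  representative y with bounded y
  ... | k , neg-k≤y , _ = (y + nat k , ≤-respˡ (neg+nat≈0 k) (+-monoˡ (nat k) neg-k≤y)) , k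

  difference-representative : ∀ y → difference (representative y) ≈ y
  difference-representative y with bounded y
  ... | k , _ = trans (+-assoc y (nat k) (neg k)) (trans (+-congˡ (nat+neg≈0 k)) (+-identityʳ y))

  T[M⁺]≅M : ULMIso (T (M ⁺)) raw
  T[M⁺]≅M = reflecting+section⇒ULMIso M differenceHom representative
              difference-representative (λ {p} {q} → difference-reflects {p} {q})

module _ {c ℓ} {M N : ULM c ℓ} (f : ULMHom (ULM.raw M) (ULM.raw N)) where
  open ULM N using (_≈_; _+_; neg)
  open CLMProps (ULM.isCLM N) using (trans; sym; +-cong; +-congˡ)
  open ULMHom f

  ULMHom-neg : ∀ n → ⟦ ULM.neg M n ⟧ ≈ neg n
  ULMHom-neg zero   = 0-homo
  ULMHom-neg (1+ n) = trans (+-homo (ULM.neg M n) (ULM.-1# M)) (+-cong (ULMHom-neg n) -1-homo)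

  difference-natural : ∀ p → TPositive.difference N (Tmap {M = M ⁺} {N = N ⁺} (plusMap {M = M} {N = N} f) p)
                               ≈ ⟦ TPositive.difference M p ⟧
  difference-natural ((x , _) , n) = sym (trans (+-homo x (ULM.neg M n)) (+-congˡ (ULMHom-neg n)))

module PositiveT {c ℓ} (M : ULMP c ℓ) where
  open ULMP M
  open CLMProps isCLM hiding (_≤_)
  open IsCLM isCLM using (+-distrib-∨; +-distrib-∧)
  open PulmFacts M using (nat-+; cancel; pos⇐; pos⇒)
  open CommutativeSemigroupProperties (CommutativeMonoid.commutativeSemigroup (+-commutativeMonoid isCLM))
    using (interchange)
  open AD _≈_ using (Congruent₂; _DistributesOverʳ_)
  open import Relation.Binary.Reasoning.Setoid setoid

  infixl 6 _⊖_
  _⊖_ : Carrier → ℕ → Carrier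
  x ⊖ zero   = x
  x ⊖ (1+ n) = (x ⊖ n) ⊖1

  +nat-cancel-≤ : ∀ n {a b} → a + nat n ≤ b + nat n → a ≤ b
  +nat-cancel-≤ n {a} {b} e = cancel n (trans (proj₂ +-distrib-∨ (nat n) a b) e)

  nat≤nat-suc : ∀ n → nat n ≤ nat (1+ n)
  nat≤nat-suc n = ≤-respˡ (+-identityʳ (nat n)) (+-monoʳ (nat n) (nonneg 1#))

  +-nat-suc : ∀ w n → w + nat (1+ n) ≈ (w + 1#) + nat n
  +-nat-suc w n = trans (+-congˡ (+-comm (nat n) 1#)) (sym (+-assoc w 1# (nat n)))

  ⊖-+-nat : ∀ x n → nat n ≤ x → (x ⊖ n) + nat n ≈ x
  ⊖-+-nat x zero   _     = +-identityʳ x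
  ⊖-+-nat x (1+ n) n+1≤x = begin
    (z ⊖1) + nat (1+ n)    ≈⟨ +-nat-suc (z ⊖1) n ⟩
    ((z ⊖1) + 1#) + nat n  ≈⟨ +-congʳ (⊖1+1 z) ⟩
    (z ∨ 1#) + nat n       ≈⟨ +-congʳ (trans (∨-comm z 1#) 1≤z) ⟩
    z + nat n              ≈⟨ z+n≈x ⟩
    x                      ∎
    where
    z = x ⊖ n
    z+n≈x : z + nat n ≈ x
    z+n≈x = ⊖-+-nat x n (≤-trans (nat≤nat-suc n) n+1≤x)
    1≤z : 1# ≤ z
    1≤z = +nat-cancel-≤ n (≤-respˡ (+-comm (nat n) 1#) (≤-respʳ (sym z+n≈x) n+1≤x))

  private module T⁺M = RawULMP (T⁺ M)

  difference : T⁺M.Carrier → Carrier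
  difference ((x , n) , _) = x ⊖ n

  difference-+nat : ∀ p → difference p + nat (proj₂ (proj₁ p)) ≈ proj₁ (proj₁ p)
  difference-+nat ((x , n) , 0≤[x,n]) = ⊖-+-nat x n (pos⇒ x n 0≤[x,n])

  +nat-shiftˡ : ∀ {a x} n m → a + nat n ≈ x → a + nat (n ℕ.+ m) ≈ x + nat m
  +nat-shiftˡ {a} n m e =
    trans (+-congˡ (nat-+ n m)) (trans (sym (+-assoc a (nat n) (nat m))) (+-congʳ e))

  +nat-shiftʳ : ∀ {a y} n m → a + nat m ≈ y → a + nat (n ℕ.+ m) ≈ y + nat n
  +nat-shiftʳ n m e = trans (+-congˡ (reflexive (P.cong nat (ℕP.+-comm n m)))) (+nat-shiftˡ m n e)

  difference-distribʳ : ∀ {_•_} → Congruent₂ _•_ → _+_ DistributesOverʳ _•_ →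
                        ∀ {a x b y} n m → a + nat n ≈ x → b + nat m ≈ y →
                        (a • b) + nat (n ℕ.+ m) ≈ (x + nat m) • (y + nat n)
  difference-distribʳ •-cong distribʳ {a} {b = b} n m ea eb =
    trans (distribʳ (nat (n ℕ.+ m)) a b) (•-cong (+nat-shiftˡ n m ea) (+nat-shiftʳ n m eb))

  -- In T⁺ M, p ⊖1 is (p + [0 , 1]) ∨ [0 , 0], whence the second line below.
  difference-⊖1 : ∀ p → difference (p T⁺M.⊖1) ≈ difference p ⊖1
  difference-⊖1 p@((x , n) , _) = cancel (n ℕ.+ 1 ℕ.+ 0) (begin
    difference (p T⁺M.⊖1) + nat (n ℕ.+ 1 ℕ.+ 0)
      ≈⟨ difference-+nat (p T⁺M.⊖1) ⟩
    ((x + 0#) + 0#) ∨ (0# + nat (n ℕ.+ 1))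
      ≈⟨ ∨-cong (trans (+-identityʳ (x + 0#)) (+-identityʳ x))
                (trans (+-identityˡ _) (reflexive (P.cong nat (ℕP.+-comm n 1)))) ⟩
    x ∨ (nat n + 1#)
      ≈⟨ ∨-cong (difference-+nat p) (+-comm 1# (nat n)) ⟨
    (a + nat n) ∨ (1# + nat n)
      ≈⟨ proj₂ +-distrib-∨ (nat n) a 1# ⟨
    (a ∨ 1#) + nat n
      ≈⟨ +-congʳ (⊖1+1 a) ⟨
    ((a ⊖1) + 1#) + nat n
      ≈⟨ +-nat-suc (a ⊖1) n ⟨
    (a ⊖1) + nat (1+ n)
      ≈⟨ +-congˡ (reflexive (P.cong nat (P.trans (ℕP.+-identityʳ (n ℕ.+ 1)) (ℕP.+-comm n 1)))) ⟨
    (a ⊖1) + nat (n ℕ.+ 1 ℕ.+ 0)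
      ∎)
    where a = difference p

  differenceHom : ULMPHom (T⁺ M) raw
  differenceHom = record
    { ⟦_⟧     = difference
    ; cong    = λ {p} {q} → difference-cong p q
    ; +-homo  = difference-+
    ; ∨-homo  = λ { p@((_ , n) , _) q@((_ , m) , _) → cancel (n ℕ.+ m)
        (trans (difference-+nat (p T⁺M.∨ q))
               (sym (difference-distribʳ ∨-cong (proj₂ +-distrib-∨) n m (difference-+nat p) (difference-+nat q)))) }
    ; ∧-homo  = λ { p@((_ , n) , _) q@((_ , m) , _) → cancel (n ℕ.+ m)
        (trans (difference-+nat (p T⁺M.∧ q))
               (sym (difference-distribʳ ∧-cong (proj₂ +-distrib-∧) n m (difference-+nat p) (difference-+nat q)))) }
    ; 0-homo  = refl
    ; 1-homo  = refl
    ; ⊖1-homo = difference-⊖1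
    }
    where
    difference-cong : ∀ p q → p T⁺M.≈ q → difference p ≈ difference q
    difference-cong p@((_ , n) , _) q@((_ , m) , _) e = cancel (n ℕ.+ m)
      (trans (+nat-shiftˡ n m (difference-+nat p)) (trans e (sym (+nat-shiftʳ n m (difference-+nat q)))))

    difference-+ : ∀ p q → difference (p T⁺M.+ q) ≈ difference p + difference q
    difference-+ p@((x , n) , _) q@((y , m) , _) = cancel (n ℕ.+ m) (begin
      difference (p T⁺M.+ q) + nat (n ℕ.+ m)  ≈⟨ difference-+nat (p T⁺M.+ q) ⟩
      x + y                                    ≈⟨ +-cong (difference-+nat p) (difference-+nat q) ⟨
      (a + nat n) + (b + nat m)                ≈⟨ interchange a b (nat n) (nat m) ⟨
      (a + b) + (nat n + nat m)                ≈⟨ +-congˡ (nat-+ n m) ⟨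
      (a + b) + nat (n ℕ.+ m)                  ∎)
      where a = difference p
            b = difference q

  difference-reflects : ∀ {p q} → difference p ≈ difference q → p T⁺M.≈ q
  difference-reflects {p@((x , n) , _)} {q@((y , m) , _)} e = begin
    x + nat m                          ≈⟨ +nat-shiftʳ m n (difference-+nat p) ⟨
    difference p + nat (m ℕ.+ n)       ≈⟨ +-congʳ e ⟩
    difference q + nat (m ℕ.+ n)       ≈⟨ +nat-shiftˡ m n (difference-+nat q) ⟩
    y + nat n                          ∎

  embed : Carrier → T⁺M.Carrier
  embed x = (x , 0) , pos⇐ x 0 (nonneg x)

  embedHom : ULMPHom raw (T⁺ M)
  embedHom = record
    { ⟦_⟧     = embed
    ; cong    = +-congʳ
    ; +-homo  = λ _ _ → refl
    ; ∨-homo  = λ x y → +-congʳ (∨-cong (sym (+-identityʳ x)) (sym (+-identityʳ y)))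
    ; ∧-homo  = λ x y → +-congʳ (∧-cong (sym (+-identityʳ x)) (sym (+-identityʳ y)))
    ; 0-homo  = refl
    ; 1-homo  = refl
    ; ⊖1-homo = λ x → difference-reflects {embed (x ⊖1)} {embed x T⁺M.⊖1} (sym (difference-⊖1 (embed x)))
    }

  T⁺[M]≅M : ULMPIso (T⁺ M) raw
  T⁺[M]≅M = record
    { to      = differenceHom
    ; from    = embedHom
    ; from∘to = λ p → difference-reflects {embed (difference p)} {p} refl
    ; to∘from = λ _ → refl
    }

module _ {c ℓ} {M N : ULMP c ℓ} (f : ULMPHom (ULMP.raw M) (ULMP.raw N)) where
  open ULMP N using (_≈_; ⊖1-cong)
  open CLMProps (ULMP.isCLM N) using (refl; trans; sym)
  open ULMPHom f
  open PositiveT using (_⊖_)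

  ULMPHom-⊖ : ∀ x n → ⟦ _⊖_ M x n ⟧ ≈ _⊖_ N ⟦ x ⟧ n
  ULMPHom-⊖ x zero   = refl
  ULMPHom-⊖ x (1+ n) = trans (⊖1-homo (_⊖_ M x n)) (⊖1-cong (ULMPHom-⊖ x n))

  difference⁺-natural : ∀ p → PositiveT.difference N (TplusMap {M = M} {N = N} f p)
                                ≈ ⟦ PositiveT.difference M p ⟧
  difference⁺-natural ((x , n) , _) = sym (ULMPHom-⊖ x n)

theorem4p16 : ∀ {c ℓ} →
    -- T ∘ (-)⁺ ≅ Id on ULM
    (Σ[ η ∈ ((M : ULM c ℓ) → ULMIso (T (M ⁺)) (ULM.raw M)) ]
      (∀ {M N : ULM c ℓ} (f : ULMHom (ULM.raw M) (ULM.raw N))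
         (p : RawULM.Carrier (T (M ⁺))) →
         ULM._≈_ N
           (ULMHom.⟦ ULMIso.to (η N) ⟧ (Tmap {M = M ⁺} {N = N ⁺} (plusMap {M = M} {N = N} f) p))
           (ULMHom.⟦ f ⟧ (ULMHom.⟦ ULMIso.to (η M) ⟧ p))))
    ×
    -- (-)⁺ ∘ T ≅ Id on ULMP
    (Σ[ ε ∈ ((M : ULMP c ℓ) → ULMPIso (T⁺ M) (ULMP.raw M)) ]
      (∀ {M N : ULMP c ℓ} (f : ULMPHom (ULMP.raw M) (ULMP.raw N))
         (p : RawULMP.Carrier (T⁺ M)) →
         ULMP._≈_ N
           (ULMPHom.⟦ ULMPIso.to (ε N) ⟧ (TplusMap {M = M} {N = N} f p))
           (ULMPHom.⟦ f ⟧ (ULMPHom.⟦ ULMPIso.to (ε M) ⟧ p))))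
theorem4p16 =
  (TPositive.T[M⁺]≅M , λ {M} {N} → difference-natural {M = M} {N}) ,
  (PositiveT.T⁺[M]≅M , λ {M} {N} → difference⁺-natural {M = M} {N})
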